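{- For every named $\mathrm{GS4}$ derivation $P$ with conclusion $\vdash\Gamma,A\land B$, $\langle\!\langle P\rangle\!\rangle=\langle\!\langle P\rangle\!\rangle{\upharpoonright}_{\mathrm{names}(\Gamma,A)}\sqcup\langle\!\langle P\rangle\!\rangle{\upharpoonright}_{\mathrm{names}(\Gamma,B)}$, where $\sqcup$ is the union of bl-graphs.
   Context: Named formulas and sequents. Fix a countably infinite set $\mathcal N$ of names and a set $\mathcal A$ of atoms with a fixpoint-free involution $\alpha\mapsto\bar\alpha$. Named formulas: $A,B::=\alpha^x\mid A\lor B\mid A\land B$ ($\alpha\in\mathcal A$, $x\in\mathcal N$); formulas $\alpha^x$ are atomic. Negation: $\overline{\alpha^x}=\bar\alpha^x$, $\overline{A\lor B}=\bar A\land\bar B$, $\overline{A\land B}=\bar A\lor\bar B$ (names preserved). $\mathrm{names}(A)$ is the set of names in $A$, $\mathrm{names}(\Gamma)=\bigcup_{A\in\Gamma}\mathrm{names}(A)$. $A\equiv B$ means $A,B$ coincide after erasing names. A formula is sharing-free if each name occurs in it at most once; a set is sharing-free if its members are sharing-free with pairwise disjoint name sets. A sequent $\vdash\Gamma$ is a finite sharing-free set $\Gamma$; in comma notation the components have pairwise disjoint name sets and $\Gamma,A=\Gamma\cup\{A\}$. Derivations. Named $\mathrm{GS4}$ derivations are finite trees of rule applications labelled with sharing-free sequents: axiom $\mathrm{ax}_{\{A,\bar B\}}$ (no premisses, conclusion $\vdash\Gamma,A,\bar B$, $A\equiv B$); cut (premisses $\vdash\Gamma,A$, $\vdash\Gamma,\bar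 A$, conclusion $\vdash\Gamma$); superposition $\sqcup$ (premisses $\vdash\Gamma$, $\vdash\Gamma$, conclusion $\vdash\Gamma$); $\lor$ (premiss $\vdash\Gamma,A,B$, conclusion $\vdash\Gamma,A\lor B$); $\land$ (premisses $\vdash\Gamma,A$, $\vdash\Gamma,B$, conclusion $\vdash\Gamma,A\land B$). Branches. $\mathrm{Br}(\alpha^x)=\{\{x\}\}$, $\mathrm{Br}(B\lor C)=\{X\cup Y\mid X\in\mathrm{Br}(B),Y\in\mathrm{Br}(C)\}$, $\mathrm{Br}(B\land C)=\mathrm{Br}(B)\cup\mathrm{Br}(C)$; for sharing-free $\Gamma$, $\mathrm{Br}(\Gamma)=\{X\subseteq\mathrm{names}(\Gamma)\mid\forall A\in\Gamma,\ X\cap\mathrm{names}(A)\in\mathrm{Br}(A)\}$. Branch-labeled graphs. A bl-graph is $G=\langle V_G,\triangleleft_G\rangle$ with $V_G\subseteq\mathcal N$ and $\triangleleft_G$ a relation between 2-element subsets $e$ of $V_G$ and subsets $X\subseteq V_G$ such that $e\triangleleft_G X$ implies $e\subseteq X$. Union $\sqcup$ is componentwise union. Restriction: $G{\upharpoonright}_X=\langle V_G\cap X,\{(e,Y)\in\triangleleft_G\mid Y\subseteq X\}\rangle$. For $I\subseteq\mathcal N$: $e\triangleleft^I_G X$ iff $e\triangleleft_G Y$ for some $Y$ with $X=Y\setminus I$. An alternating $X$-labeled path between bl-graphs $G,H$ through $I$ is a sequence $x_1,\dots,x_n$ ($n>1$) of pairwise distinct vertices of $G$ or $H$ with $x_i\in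 I$ for $1<i<n$ such that either $x_ix_{i+1}\triangleleft^I_G X$ for all odd $i$ and $x_ix_{i+1}\triangleleft^I_H X$ for all even $i$, or the same with $G,H$ swapped; it is complete if $x_1,x_n\notin I$. $G\odot_I H$ has vertex set $V=(V_G\cup V_H)\setminus I$ and, for $x\ne y\in V$, $X\subseteq V$, $xy\triangleleft X$ iff there is a complete alternating $X$-labeled path from $x$ to $y$ between $G$ and $H$ through $I$; $\odot_A=\odot_{\mathrm{names}(A)}$. $\mathrm{wk}_\Gamma(G)=\langle V_G\cup\mathrm{names}(\Gamma),\{(e,X\cup Y)\mid e\triangleleft_G X,\,Y\in\mathrm{Br}(\Gamma)\}\rangle$. $\mathrm{id}_{\{\alpha^x,\bar\alpha^y\}}=\langle\{x,y\},\{(xy,\{x,y\})\}\rangle$, and for disjoint sharing-free $A_1\lor A_2$, $\bar B_1\land\bar B_2$ with $A_i\equiv B_i$, $\mathrm{id}_{\{A_1\lor A_2,\bar B_1\land\bar B_2\}}=\mathrm{wk}_{\{A_2\}}(\mathrm{id}_{\{A_1,\bar B_1\}})\sqcup\mathrm{wk}_{\{A_1\}}(\mathrm{id}_{\{A_2,\bar B_2\}})$ (every axiom pair of non-atomic formulas is an unordered pair of this shape). $\langle\!\langle P\rangle\!\rangle$ is $\mathrm{wk}_\Gamma(\mathrm{id}_{\{A,\bar B\}})$ for an axiom $\mathrm{ax}_{\{A,\bar B\}}$ with conclusion $\vdash\Gamma,A,\bar B$; $\langle\!\langle Q\rangle\!\rangle\odot_A\langle\!\langle R\rangle\!\rangle$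 for a cut with premiss derivations $Q$ of $\vdash\Gamma,A$, $R$ of $\vdash\Gamma,\bar A$; the union of the premisses' bl-graphs for $\sqcup,\lor,\land$. -}

module Defs where

open import Data.Nat using (ℕ)
open import Data.List using (List; []; _∷_; _++_; map; concatMap)
open import Data.List.Membership.Propositional using (_∈_; _∉_)
open import Data.List.Relation.Binary.Permutation.Propositional using (_↭_)
open import Data.List.Relation.Unary.All using (All)
open import Data.List.Relation.Unary.AllPairs using (AllPairs)
open import Data.List.Relation.Unary.Unique.Propositional using (Unique)
open import Data.Product using (Σ; ∃; ∃-syntax; _×_; _,_)
open import Data.Sum using (_⊎_)
open import Data.Empty using (⊥)
open import Data.Unit using (⊤)
open import Relation.Binary.PropositionalEquality using (_≡_; _≢_)
open import Relation.Nullary using (¬_)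

Name : Set
Name = ℕ

_iff_ : Set → Set → Set
P iff Q = (P → Q) × (Q → P)

-- Finite sets of names are represented by lists, compared extensionally.
NameSet : Set
NameSet = List Name

_≐_ : NameSet → NameSet → Set
X ≐ Y = ∀ z → (z ∈ X) iff (z ∈ Y)

_⊆ₙ_ : NameSet → NameSet → Set
X ⊆ₙ Y = ∀ {z} → z ∈ X → z ∈ Y

record AtomSet : Set₁ where
  field
    Atom      : Set
    bar       : Atom → Atom
    bar-invol : ∀ a → bar (bar a) ≡ a
    bar-fpf   : ∀ a → bar a ≢ a

module Named (𝒜 : AtomSet) where
  open AtomSet 𝒜

  infixr 6 _∨_
  infixr 7 _∧_

  data Formula : Set where
    atom : Atom → Name → Formula
    _∨_  : Formula → Formula → Formula
    _∧_  : Formula → Formula → Formula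

  data Shape : Set where
    atomˢ : Atom → Shape
    _∨ˢ_  : Shape → Shape → Shape
    _∧ˢ_  : Shape → Shape → Shape

  erase : Formula → Shape
  erase (atom a x) = atomˢ a
  erase (A ∨ B)    = erase A ∨ˢ erase B
  erase (A ∧ B)    = erase A ∧ˢ erase B

  _≃_ : Formula → Formula → Set
  A ≃ B = erase A ≡ erase B

  neg : Formula → Formula
  neg (atom a x) = atom (bar a) x
  neg (A ∨ B)    = neg A ∧ neg B
  neg (A ∧ B)    = neg A ∨ neg B

  names : Formula → NameSet
  names (atom a x) = x ∷ []
  names (A ∨ B)    = names A ++ names B
  names (A ∧ B)    = names A ++ names B

  -- sequents: finite sets of formulas, represented as lists (up to permutation)
  Seq : Set
  Seq = List Formula

  namesS : Seq → NameSet
  namesS = concatMap names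

  Disjoint : NameSet → NameSet → Set
  Disjoint X Y = ∀ {z} → z ∈ X → z ∉ Y

  SharingFreeF : Formula → Set
  SharingFreeF A = Unique (names A)

  SharingFree : Seq → Set
  SharingFree Γ = All SharingFreeF Γ × AllPairs Disjoint (map names Γ)

  Br : Formula → NameSet → Set
  Br (atom a x) X = X ≐ (x ∷ [])
  Br (B ∨ C)    X = ∃[ Y ] ∃[ Z ] (Br B Y × Br C Z × X ≐ (Y ++ Z))
  Br (B ∧ C)    X = Br B X ⊎ Br C X

  BrS : Seq → NameSet → Set
  BrS Γ X = X ⊆ₙ namesS Γ
          × All (λ A → ∃[ Y ] (Br A Y × (∀ z → (z ∈ Y) iff (z ∈ X × z ∈ names A)))) Γ

  -- Derivations (each node labelled by a sharing-free sequent; the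
  -- conclusion of each rule is given up to permutation of the list)

  data Deriv : Seq → Set where
    ax  : ∀ {Δ} (Γ : Seq) (A B : Formula) → A ≃ B →
          Δ ↭ (A ∷ neg B ∷ Γ) → SharingFree Δ → Deriv Δ
    cut : ∀ {Δ} (Γ : Seq) (A : Formula) →
          Deriv (A ∷ Γ) → Deriv (neg A ∷ Γ) →
          Δ ↭ Γ → SharingFree Δ → Deriv Δ
    sup : ∀ {Δ} (Γ : Seq) → Deriv Γ → Deriv Γ →
          Δ ↭ Γ → SharingFree Δ → Deriv Δ
    or  : ∀ {Δ} (Γ : Seq) (A B : Formula) → Deriv (A ∷ B ∷ Γ) →
          Δ ↭ ((A ∨ B) ∷ Γ) → SharingFree Δ → Deriv Δ
    and : ∀ {Δ} (Γ : Seq) (A B : Formula) → Deriv (A ∷ Γ) → Deriv (B ∷ Γ) →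
          Δ ↭ ((A ∧ B) ∷ Γ) → SharingFree Δ → Deriv Δ

  -- Branch-labelled graphs.  E x y X stands for {x,y} ◁ X; graphs are
  -- compared up to unordered edges and extensional equality of labels.

  record BlGraph : Set₁ where
    field
      V : Name → Set
      E : Name → Name → NameSet → Set
  open BlGraph public

  Edge : BlGraph → Name → Name → NameSet → Set
  Edge G x y X = ∃[ Y ] (X ≐ Y × (E G x y Y ⊎ E G y x Y))

  _≅_ : BlGraph → BlGraph → Set
  G ≅ H = (∀ z → V G z iff V H z) × (∀ x y X → Edge G x y X iff Edge H x y X)

  _⊔_ : BlGraph → BlGraph → BlGraph
  G ⊔ H = record { V = λ z → V G z ⊎ V H z ; E = λ x y X → E G x y X ⊎ E H x y X }

  _↾_ : BlGraph → NameSet → BlGraph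
  G ↾ X = record { V = λ z → V G z × z ∈ X ; E = λ x y Y → E G x y Y × Y ⊆ₙ X }

  StepI : BlGraph → NameSet → Name → Name → NameSet → Set
  StepI G I x y X = ∃[ Y ] ((E G x y Y ⊎ E G y x Y) × (∀ z → (z ∈ X) iff (z ∈ Y × z ∉ I)))

  AltFrom : BlGraph → BlGraph → NameSet → NameSet → List Name → Set
  AltFrom G H I X []           = ⊥
  AltFrom G H I X (x ∷ [])     = ⊤
  AltFrom G H I X (x ∷ y ∷ ps) = StepI G I x y X × AltFrom H G I X (y ∷ ps)

  CompleteAltPath : BlGraph → BlGraph → NameSet → NameSet → Name → Name → Set
  CompleteAltPath G H I X x y =
    ∃[ mid ] (let ps = x ∷ (mid ++ y ∷ []) in
        Unique ps
      × All (λ v → V G v ⊎ V H v) ps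
      × All (λ v → v ∈ I) mid
      × x ∉ I × y ∉ I
      × (AltFrom G H I X ps ⊎ AltFrom H G I X ps))

  comp : NameSet → BlGraph → BlGraph → BlGraph
  comp I G H = record
    { V = Vc
    ; E = λ x y X → x ≢ y × Vc x × Vc y × (∀ {z} → z ∈ X → Vc z)
                    × CompleteAltPath G H I X x y }
    where
      Vc : Name → Set
      Vc z = (V G z ⊎ V H z) × z ∉ I

  wk : Seq → BlGraph → BlGraph
  wk Γ G = record
    { V = λ z → V G z ⊎ z ∈ namesS Γ
    ; E = λ x y Z → ∃[ X ] ∃[ Y ] (E G x y X × BrS Γ Y × Z ≐ (X ++ Y)) }

  emptyG : BlGraph
  emptyG = record { V = λ _ → ⊥ ; E = λ _ _ _ → ⊥ }

  -- id_{A, C} for an axiom pair {A, C} (C = neg B with A ≃ B);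
  -- pairs not of axiom shape never arise and are mapped to the empty graph.
  idG : Formula → Formula → BlGraph
  idG (atom a x) (atom b y) =
    record { V = λ z → z ∈ (x ∷ y ∷ []) ; E = λ u v X → u ≡ x × v ≡ y × X ≐ (x ∷ y ∷ []) }
  idG (A₁ ∨ A₂) (C₁ ∧ C₂) = wk (A₂ ∷ []) (idG A₁ C₁) ⊔ wk (A₁ ∷ []) (idG A₂ C₂)
  idG (C₁ ∧ C₂) (A₁ ∨ A₂) = wk (A₂ ∷ []) (idG A₁ C₁) ⊔ wk (A₁ ∷ []) (idG A₂ C₂)
  idG _ _ = emptyG

  ⟦_⟧ : ∀ {Δ} → Deriv Δ → BlGraph
  ⟦ ax Γ A B _ _ _ ⟧      = wk Γ (idG A (neg B))
  ⟦ cut Γ A Q R _ _ ⟧     = comp (names A) ⟦ Q ⟧ ⟦ R ⟧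
  ⟦ sup Γ Q R _ _ ⟧       = ⟦ Q ⟧ ⊔ ⟦ R ⟧
  ⟦ or Γ A B Q _ _ ⟧      = ⟦ Q ⟧
  ⟦ and Γ A B Q R _ _ ⟧   = ⟦ Q ⟧ ⊔ ⟦ R ⟧

module Submission where

-- Every edge label Z of ⟦ P ⟧, for P a derivation of ⊢ Δ, lies within names(Δ) and meets each
-- C ∈ Δ inside a single branch of C.  The invariant holds for identity graphs and is preserved
-- by weakening (which adds a branch of the new formulas), by cut (which only deletes the cut
-- names from a premiss label) and by the ∧ rule, since a label of the premiss ⊢ Γ, A avoids
-- the names of B by sharing-freeness.  For the conclusion ⊢ Γ, A ∧ B every label thus avoids
-- names(B) or names(A), so it lies within names(Γ, A) or names(Γ, B); vertices are handled alike.

open import Defs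
open import Data.Empty using (⊥-elim)
open import Data.List using (List; []; _∷_; _++_)
open import Data.List.Properties using (++-assoc)
open import Data.List.Membership.Propositional using (_∈_; _∉_)
open import Data.List.Membership.Propositional.Properties using (∈-++⁺ˡ; ∈-++⁺ʳ; ∈-++⁻)
open import Data.List.Relation.Unary.Any using (here; there)
open import Data.List.Relation.Unary.All as All using (All; []; _∷_)
import Data.List.Relation.Unary.All.Properties as All
import Data.List.Relation.Unary.AllPairs as AllPairs
open import Data.List.Relation.Unary.Unique.Propositional using (Unique)
import Data.List.Relation.Unary.Unique.Propositional.Properties as Unique
open import Data.List.Relation.Binary.Permutation.Propositional as ↭ using (_↭_; ↭-sym; ↭⇒↭ₛ)
open import Data.List.Relation.Binary.Permutation.Propositional.Properties
  using (All-resp-↭; ∈-resp-↭; ++⁺ˡ; shifts; ++-comm)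
import Data.List.Relation.Binary.Permutation.Setoid.Properties as Permutationₛ
open import Data.Product as Product using (∃₂; _×_; _,_; proj₁; proj₂)
open import Data.Sum as Sum using (_⊎_; inj₁; inj₂; [_,_])
open import Data.Unit using (⊤; tt)
open import Function using (id)
open import Relation.Binary.PropositionalEquality as ≡ using (_≡_; refl; cong; subst)

module _ {a} {A : Set a} where

  Unique-++⁻ˡ : ∀ (xs : List A) {ys} → Unique (xs ++ ys) → Unique xs
  Unique-++⁻ˡ []       _                 = AllPairs.[]
  Unique-++⁻ˡ (x ∷ xs) (x∉ AllPairs.∷ u) = All.++⁻ˡ xs x∉ AllPairs.∷ Unique-++⁻ˡ xs u

  Unique-++⁻ʳ : ∀ (xs : List A) {ys} → Unique (xs ++ ys) → Unique ys
  Unique-++⁻ʳ []       u                = u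
  Unique-++⁻ʳ (x ∷ xs) (_ AllPairs.∷ u) = Unique-++⁻ʳ xs u

  Unique-++⇒disjoint : ∀ (xs : List A) {ys z} → Unique (xs ++ ys) → z ∈ xs → z ∉ ys
  Unique-++⇒disjoint (x ∷ xs) (x∉ AllPairs.∷ _) (here refl) z∈ys = All.lookup x∉ (∈-++⁺ʳ xs z∈ys) refl
  Unique-++⇒disjoint (x ∷ xs) (_ AllPairs.∷ u)  (there z∈xs)      = Unique-++⇒disjoint xs u z∈xs

  Unique-resp-↭ : ∀ {xs ys : List A} → xs ↭ ys → Unique xs → Unique ys
  Unique-resp-↭ p = Permutationₛ.Unique-resp-↭ (≡.setoid A) (↭⇒↭ₛ p)

module BranchLabels (𝒜 : AtomSet) where
  open Named 𝒜 public

  names-neg : ∀ A → names (neg A) ≡ names A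
  names-neg (atom _ _) = refl
  names-neg (A ∨ B)    = ≡.cong₂ _++_ (names-neg A) (names-neg B)
  names-neg (A ∧ B)    = ≡.cong₂ _++_ (names-neg A) (names-neg B)

  namesS-++ : ∀ Δ Γ → namesS (Δ ++ Γ) ≡ namesS Δ ++ namesS Γ
  namesS-++ []      Γ = refl
  namesS-++ (C ∷ Δ) Γ =
    ≡.trans (cong (names C ++_) (namesS-++ Δ Γ)) (≡.sym (++-assoc (names C) (namesS Δ) (namesS Γ)))

  namesS-↭ : ∀ {Δ Δ′} → Δ ↭ Δ′ → namesS Δ ↭ namesS Δ′
  namesS-↭ ↭.refl         = ↭.refl
  namesS-↭ (↭.prep C p)   = ++⁺ˡ (names C) (namesS-↭ p)
  namesS-↭ (↭.swap C D p) =
    ↭.trans (shifts (names C) (names D)) (++⁺ˡ (names D) (++⁺ˡ (names C) (namesS-↭ p)))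
  namesS-↭ (↭.trans p q)  = ↭.trans (namesS-↭ p) (namesS-↭ q)

  namesS-unfold : ∀ Δ {C A B Γ} → names C ≡ names A ++ names B →
                  namesS (Δ ++ C ∷ Γ) ≡ namesS (Δ ++ A ∷ B ∷ Γ)
  namesS-unfold []      {A = A} {B} {Γ} eq =
    ≡.trans (cong (_++ namesS Γ) eq) (++-assoc (names A) (names B) (namesS Γ))
  namesS-unfold (D ∷ Δ) eq = cong (names D ++_) (namesS-unfold Δ eq)

  ∈-namesS : ∀ {C Γ z} → C ∈ Γ → z ∈ names C → z ∈ namesS Γ
  ∈-namesS {Γ = C ∷ _} (here refl) z∈ = ∈-++⁺ˡ z∈
  ∈-namesS {Γ = D ∷ _} (there C∈) z∈ = ∈-++⁺ʳ (names D) (∈-namesS C∈ z∈)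

  ∈-namesS-++⁺ˡ : ∀ Δ {Γ z} → z ∈ namesS Δ → z ∈ namesS (Δ ++ Γ)
  ∈-namesS-++⁺ˡ Δ {Γ} {z} z∈ = subst (z ∈_) (≡.sym (namesS-++ Δ Γ)) (∈-++⁺ˡ z∈)

  ∈-namesS-++⁺ʳ : ∀ Δ {Γ z} → z ∈ namesS Γ → z ∈ namesS (Δ ++ Γ)
  ∈-namesS-++⁺ʳ Δ {Γ} {z} z∈ = subst (z ∈_) (≡.sym (namesS-++ Δ Γ)) (∈-++⁺ʳ (namesS Δ) z∈)

  ∈-namesS-∷⁻ : ∀ C {Γ z} → z ∈ namesS (C ∷ Γ) → z ∉ names C → z ∈ namesS Γ
  ∈-namesS-∷⁻ C z∈ z∉C = [ (λ zC → ⊥-elim (z∉C zC)) , id ] (∈-++⁻ (names C) z∈)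

  ∈-namesS-∨ : ∀ A B {Γ z} → z ∈ namesS (A ∷ B ∷ Γ) → z ∈ namesS (A ∨ B ∷ Γ)
  ∈-namesS-∨ A B {Γ} {z} = subst (z ∈_) (≡.sym (namesS-unfold [] {A ∨ B} {A} {B} {Γ} refl))

  ∈-namesS-∧ˡ : ∀ A B {Γ z} → z ∈ namesS (A ∷ Γ) → z ∈ namesS (A ∧ B ∷ Γ)
  ∈-namesS-∧ˡ A B z∈ = [ (λ zA → ∈-++⁺ˡ (∈-++⁺ˡ zA)) , ∈-++⁺ʳ (names A ++ names B) ] (∈-++⁻ (names A) z∈)

  ∈-namesS-∧ʳ : ∀ A B {Γ z} → z ∈ namesS (B ∷ Γ) → z ∈ namesS (A ∧ B ∷ Γ)
  ∈-namesS-∧ʳ A B z∈ = [ (λ zB → ∈-++⁺ˡ (∈-++⁺ʳ (names A) zB)) , ∈-++⁺ʳ (names A ++ names B) ] (∈-++⁻ (names B) z∈)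

  ∈-namesS-∧⁻ : ∀ A B {Γ z} → z ∈ namesS (A ∧ B ∷ Γ) → z ∈ namesS (A ∷ Γ) ⊎ z ∈ namesS (B ∷ Γ)
  ∈-namesS-∧⁻ A B z∈ with ∈-++⁻ (names A ++ names B) z∈
  ... | inj₂ zΓ = inj₁ (∈-++⁺ʳ (names A) zΓ)
  ... | inj₁ zAB = Sum.map ∈-++⁺ˡ ∈-++⁺ˡ (∈-++⁻ (names A) zAB)

  ∈-namesS-∧⁻ˡ : ∀ A B {Γ z} → z ∈ namesS (A ∧ B ∷ Γ) → z ∉ names B → z ∈ namesS (A ∷ Γ)
  ∈-namesS-∧⁻ˡ A B {Γ} z∈ z∉B =
    [ id , (λ zBΓ → ∈-++⁺ʳ (names A) (∈-namesS-∷⁻ B {Γ} zBΓ z∉B)) ] (∈-namesS-∧⁻ A B {Γ} z∈)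

  ∈-namesS-∧⁻ʳ : ∀ A B {Γ z} → z ∈ namesS (A ∧ B ∷ Γ) → z ∉ names A → z ∈ namesS (B ∷ Γ)
  ∈-namesS-∧⁻ʳ A B {Γ} z∈ z∉A =
    [ (λ zAΓ → ∈-++⁺ʳ (names B) (∈-namesS-∷⁻ A {Γ} zAΓ z∉A)) , id ] (∈-namesS-∧⁻ A B {Γ} z∈)

  Distinct : Seq → Set
  Distinct Δ = Unique (namesS Δ)

  SharingFree⇒Distinct : ∀ {Δ} → SharingFree Δ → Distinct Δ
  SharingFree⇒Distinct (u , d) = Unique.concat⁺ (All.map⁺ u) (AllPairs.map (λ d′ {_} (zx , zy) → d′ zx zy) d)

  Distinct-↭ : ∀ {Δ Δ′} → Δ ↭ Δ′ → Distinct Δ → Distinct Δ′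
  Distinct-↭ p = Unique-resp-↭ (namesS-↭ p)

  Distinct-unfold : ∀ Δ {C A B Γ} → names C ≡ names A ++ names B →
                    Distinct (Δ ++ C ∷ Γ) → Distinct (Δ ++ A ∷ B ∷ Γ)
  Distinct-unfold Δ eq = subst Unique (namesS-unfold Δ eq)

  Distinct-++ : ∀ Δ {Γ} → Distinct (Δ ++ Γ) → Unique (namesS Δ ++ namesS Γ)
  Distinct-++ Δ {Γ} = subst Unique (namesS-++ Δ Γ)

  Distinct-++⁻ˡ : ∀ Δ {Γ} → Distinct (Δ ++ Γ) → Distinct Δ
  Distinct-++⁻ˡ Δ U = Unique-++⁻ˡ (namesS Δ) (Distinct-++ Δ U)

  Distinct⇒Unique-names : ∀ {Γ} → Distinct Γ → All (λ C → Unique (names C)) Γ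
  Distinct⇒Unique-names {[]}    _ = []
  Distinct⇒Unique-names {C ∷ Γ} U = Unique-++⁻ˡ (names C) U ∷ Distinct⇒Unique-names (Unique-++⁻ʳ (names C) U)

  Distinct-∧⇒disjointˡ : ∀ A B {Γ} → Distinct (A ∧ B ∷ Γ) → Disjoint (namesS (A ∷ Γ)) (names B)
  Distinct-∧⇒disjointˡ A B U z∈ zB with ∈-++⁻ (names A) z∈
  ... | inj₁ zA = Unique-++⇒disjoint (names A) (Unique-++⁻ˡ (names A ++ names B) U) zA zB
  ... | inj₂ zΓ = Unique-++⇒disjoint (names A ++ names B) U (∈-++⁺ʳ (names A) zB) zΓ

  Distinct-∧⇒disjointʳ : ∀ A B {Γ} → Distinct (A ∧ B ∷ Γ) → Disjoint (namesS (B ∷ Γ)) (names A)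
  Distinct-∧⇒disjointʳ A B U z∈ zA with ∈-++⁻ (names B) z∈
  ... | inj₁ zB = Unique-++⇒disjoint (names A) (Unique-++⁻ˡ (names A ++ names B) U) zA zB
  ... | inj₂ zΓ = Unique-++⇒disjoint (names A ++ names B) U (∈-++⁺ˡ zA) zΓ

  -- For sharing-free C, InBranch C Z holds iff Z ∩ names C is contained in a branch of C.
  InBranch : Formula → NameSet → Set
  InBranch (atom _ _) Z = ⊤
  InBranch (A ∨ B)    Z = InBranch A Z × InBranch B Z
  InBranch (A ∧ B)    Z = (Disjoint Z (names B) × InBranch A Z) ⊎ (Disjoint Z (names A) × InBranch B Z)

  InBranch-mono : ∀ C {Z Z′} → InBranch C Z → (∀ {z} → z ∈ Z′ → z ∈ names C → z ∈ Z) → InBranch C Z′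
  InBranch-mono (atom _ _) _ _ = tt
  InBranch-mono (A ∨ B) (iA , iB) sub =
    InBranch-mono A iA (λ z∈ zA → sub z∈ (∈-++⁺ˡ zA)) , InBranch-mono B iB (λ z∈ zB → sub z∈ (∈-++⁺ʳ (names A) zB))
  InBranch-mono (A ∧ B) (inj₁ (Z#B , iA)) sub =
    inj₁ ((λ z∈ zB → Z#B (sub z∈ (∈-++⁺ʳ (names A) zB)) zB) , InBranch-mono A iA (λ z∈ zA → sub z∈ (∈-++⁺ˡ zA)))
  InBranch-mono (A ∧ B) (inj₂ (Z#A , iB)) sub =
    inj₂ ((λ z∈ zA → Z#A (sub z∈ (∈-++⁺ˡ zA)) zA) , InBranch-mono B iB (λ z∈ zB → sub z∈ (∈-++⁺ʳ (names A) zB)))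

  Br⇒⊆names : ∀ C {Y} → Br C Y → Y ⊆ₙ names C
  Br⇒⊆names (atom _ _) Y≐ {z} z∈ = proj₁ (Y≐ z) z∈
  Br⇒⊆names (A ∨ B) (Y₁ , Y₂ , b₁ , b₂ , Y≐) {z} z∈ with ∈-++⁻ Y₁ (proj₁ (Y≐ z) z∈)
  ... | inj₁ z∈₁ = ∈-++⁺ˡ (Br⇒⊆names A b₁ z∈₁)
  ... | inj₂ z∈₂ = ∈-++⁺ʳ (names A) (Br⇒⊆names B b₂ z∈₂)
  Br⇒⊆names (A ∧ B) (inj₁ b) z∈ = ∈-++⁺ˡ (Br⇒⊆names A b z∈)
  Br⇒⊆names (A ∧ B) (inj₂ b) z∈ = ∈-++⁺ʳ (names A) (Br⇒⊆names B b z∈)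

  Br⇒InBranch : ∀ C {Y Z} → Unique (names C) → Br C Y → (∀ {z} → z ∈ Z → z ∈ names C → z ∈ Y) → InBranch C Z
  Br⇒InBranch (atom _ _) _ _ _ = tt
  Br⇒InBranch (A ∨ B) {Z = Z} u (Y₁ , Y₂ , b₁ , b₂ , Y≐) sub =
    Br⇒InBranch A (Unique-++⁻ˡ (names A) u) b₁ subA , Br⇒InBranch B (Unique-++⁻ʳ (names A) u) b₂ subB
    where
      A#B : Disjoint (names A) (names B)
      A#B = Unique-++⇒disjoint (names A) u
      subA : ∀ {z} → z ∈ Z → z ∈ names A → z ∈ Y₁
      subA {z} z∈ zA = [ id , (λ z∈₂ → ⊥-elim (A#B zA (Br⇒⊆names B b₂ z∈₂))) ]
                         (∈-++⁻ Y₁ (proj₁ (Y≐ z) (sub z∈ (∈-++⁺ˡ zA))))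
      subB : ∀ {z} → z ∈ Z → z ∈ names B → z ∈ Y₂
      subB {z} z∈ zB = [ (λ z∈₁ → ⊥-elim (A#B (Br⇒⊆names A b₁ z∈₁) zB)) , id ]
                         (∈-++⁻ Y₁ (proj₁ (Y≐ z) (sub z∈ (∈-++⁺ʳ (names A) zB))))
  Br⇒InBranch (A ∧ B) u (inj₁ b) sub =
    inj₁ ( (λ z∈ zB → Unique-++⇒disjoint (names A) u (Br⇒⊆names A b (sub z∈ (∈-++⁺ʳ (names A) zB))) zB)
         , Br⇒InBranch A (Unique-++⁻ˡ (names A) u) b (λ z∈ zA → sub z∈ (∈-++⁺ˡ zA)))
  Br⇒InBranch (A ∧ B) u (inj₂ b) sub =
    inj₂ ( (λ z∈ zA → Unique-++⇒disjoint (names A) u zA (Br⇒⊆names B b (sub z∈ (∈-++⁺ˡ zA))))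
         , Br⇒InBranch B (Unique-++⁻ʳ (names A) u) b (λ z∈ zB → sub z∈ (∈-++⁺ʳ (names A) zB)))

  BrS⇒InBranch : ∀ Γ {Y Z} → Distinct Γ → BrS Γ Y →
                 (∀ {z} → z ∈ Z → z ∈ namesS Γ → z ∈ Y) → All (λ C → InBranch C Z) Γ
  BrS⇒InBranch Γ U (_ , brs) sub = All.tabulate λ {C} C∈Γ →
    let (W , b , W≐) = All.lookup brs C∈Γ in
    Br⇒InBranch C (All.lookup (Distinct⇒Unique-names U) C∈Γ) b
      (λ {z} z∈ zC → proj₂ (W≐ z) (sub z∈ (∈-namesS C∈Γ zC) , zC))

  InBranchS : Seq → NameSet → Set
  InBranchS Δ Z = Z ⊆ₙ namesS Δ × All (λ C → InBranch C Z) Δ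

  InBranchS-↭ : ∀ {Δ Δ′ Z} → Δ ↭ Δ′ → InBranchS Δ Z → InBranchS Δ′ Z
  InBranchS-↭ p (Z⊆ , iΔ) = (λ z∈ → ∈-resp-↭ (namesS-↭ p) (Z⊆ z∈)) , All-resp-↭ p iΔ

  InBranchS-∨ : ∀ A B {Γ Z} → InBranchS (A ∷ B ∷ Γ) Z → InBranchS (A ∨ B ∷ Γ) Z
  InBranchS-∨ A B {Γ} (Z⊆ , iA ∷ iB ∷ iΓ) = (λ z∈ → ∈-namesS-∨ A B {Γ} (Z⊆ z∈)) , (iA , iB) ∷ iΓ

  InBranchS-∧ˡ : ∀ A B {Γ Z} → Distinct (A ∧ B ∷ Γ) → InBranchS (A ∷ Γ) Z → InBranchS (A ∧ B ∷ Γ) Z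
  InBranchS-∧ˡ A B {Γ} U (Z⊆ , iA ∷ iΓ) =
    (λ z∈ → ∈-namesS-∧ˡ A B {Γ} (Z⊆ z∈)) , inj₁ ((λ z∈ → Distinct-∧⇒disjointˡ A B {Γ} U (Z⊆ z∈)) , iA) ∷ iΓ

  InBranchS-∧ʳ : ∀ A B {Γ Z} → Distinct (A ∧ B ∷ Γ) → InBranchS (B ∷ Γ) Z → InBranchS (A ∧ B ∷ Γ) Z
  InBranchS-∧ʳ A B {Γ} U (Z⊆ , iB ∷ iΓ) =
    (λ z∈ → ∈-namesS-∧ʳ A B {Γ} (Z⊆ z∈)) , inj₂ ((λ z∈ → Distinct-∧⇒disjointʳ A B {Γ} U (Z⊆ z∈)) , iB) ∷ iΓ

  InBranchS-∷⁻ : ∀ C {Γ Y Z} → InBranchS (C ∷ Γ) Y → (∀ {z} → z ∈ Z → z ∈ Y × z ∉ names C) → InBranchS Γ Z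
  InBranchS-∷⁻ C {Γ} (Y⊆ , _ ∷ iΓ) sub =
    (λ z∈ → ∈-namesS-∷⁻ C {Γ} (Y⊆ (proj₁ (sub z∈))) (proj₂ (sub z∈)))
    , All.map (λ {D} iD → InBranch-mono D iD (λ z∈ _ → proj₁ (sub z∈))) iΓ

  InBranchS-wk : ∀ Δ {Γ X Y Z} → Distinct (Δ ++ Γ) → InBranchS Δ X → BrS Γ Y → Z ≐ (X ++ Y) →
                 InBranchS (Δ ++ Γ) Z
  InBranchS-wk Δ {Γ} {X} {Y} {Z} U (X⊆ , iΔ) (Y⊆ , brs) Z≐ = Z⊆ , All.++⁺ iΔ′ iΓ
    where
      Δ#Γ : Disjoint (namesS Δ) (namesS Γ)
      Δ#Γ = Unique-++⇒disjoint (namesS Δ) (Distinct-++ Δ U)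
      split : ∀ {z} → z ∈ Z → z ∈ X ⊎ z ∈ Y
      split {z} z∈ = ∈-++⁻ X (proj₁ (Z≐ z) z∈)
      Z⊆ : Z ⊆ₙ namesS (Δ ++ Γ)
      Z⊆ z∈ = [ (λ zX → ∈-namesS-++⁺ˡ Δ (X⊆ zX)) , (λ zY → ∈-namesS-++⁺ʳ Δ (Y⊆ zY)) ] (split z∈)
      iΔ′ : All (λ C → InBranch C Z) Δ
      iΔ′ = All.tabulate λ {C} C∈Δ → InBranch-mono C (All.lookup iΔ C∈Δ) λ z∈ zC →
              [ id , (λ zY → ⊥-elim (Δ#Γ (∈-namesS C∈Δ zC) (Y⊆ zY))) ] (split z∈)
      iΓ : All (λ C → InBranch C Z) Γ
      iΓ = BrS⇒InBranch Γ (Unique-++⁻ʳ (namesS Δ) (Distinct-++ Δ U)) (Y⊆ , brs) λ z∈ zΓ →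
              [ (λ zX → ⊥-elim (Δ#Γ (X⊆ zX) zΓ)) , id ] (split z∈)

  InBranchS-∧⁻ : ∀ A B {Γ Z} → InBranchS (A ∧ B ∷ Γ) Z → Z ⊆ₙ namesS (A ∷ Γ) ⊎ Z ⊆ₙ namesS (B ∷ Γ)
  InBranchS-∧⁻ A B {Γ} (Z⊆ , inj₁ (Z#B , _) ∷ _) = inj₁ λ z∈ → ∈-namesS-∧⁻ˡ A B {Γ} (Z⊆ z∈) (Z#B z∈)
  InBranchS-∧⁻ A B {Γ} (Z⊆ , inj₂ (Z#A , _) ∷ _) = inj₂ λ z∈ → ∈-namesS-∧⁻ʳ A B {Γ} (Z⊆ z∈) (Z#A z∈)

  record Fits (G : BlGraph) (Δ : Seq) : Set where
    constructor fits
    field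
      vertices : ∀ {z} → V G z → z ∈ namesS Δ
      labels   : ∀ {x y Z} → E G x y Z → InBranchS Δ Z

  Fits-map : ∀ {G Δ Δ′} → (∀ {z} → z ∈ namesS Δ → z ∈ namesS Δ′) → (∀ {Z} → InBranchS Δ Z → InBranchS Δ′ Z) →
             Fits G Δ → Fits G Δ′
  Fits-map f g (fits vG eG) = fits (λ v → f (vG v)) (λ e → g (eG e))

  Fits-↭ : ∀ {G Δ Δ′} → Δ ↭ Δ′ → Fits G Δ → Fits G Δ′
  Fits-↭ p = Fits-map (∈-resp-↭ (namesS-↭ p)) (InBranchS-↭ p)

  Fits-∨ : ∀ {G} A B {Γ} → Fits G (A ∷ B ∷ Γ) → Fits G (A ∨ B ∷ Γ)
  Fits-∨ A B {Γ} = Fits-map (∈-namesS-∨ A B {Γ}) (InBranchS-∨ A B)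

  Fits-∧ˡ : ∀ {G} A B {Γ} → Distinct (A ∧ B ∷ Γ) → Fits G (A ∷ Γ) → Fits G (A ∧ B ∷ Γ)
  Fits-∧ˡ A B {Γ} U = Fits-map (∈-namesS-∧ˡ A B {Γ}) (InBranchS-∧ˡ A B U)

  Fits-∧ʳ : ∀ {G} A B {Γ} → Distinct (A ∧ B ∷ Γ) → Fits G (B ∷ Γ) → Fits G (A ∧ B ∷ Γ)
  Fits-∧ʳ A B {Γ} U = Fits-map (∈-namesS-∧ʳ A B {Γ}) (InBranchS-∧ʳ A B U)

  Fits-⊔ : ∀ {G H Δ} → Fits G Δ → Fits H Δ → Fits (G ⊔ H) Δ
  Fits-⊔ (fits vG eG) (fits vH eH) = fits [ vG , vH ] [ eG , eH ]

  Fits-wk : ∀ Δ {Γ G} → Distinct (Δ ++ Γ) → Fits G Δ → Fits (wk Γ G) (Δ ++ Γ)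
  Fits-wk Δ U (fits vG eG) = fits
    [ (λ v → ∈-namesS-++⁺ˡ Δ (vG v)) , ∈-namesS-++⁺ʳ Δ ]
    λ (_ , _ , e , brs , Z≐) → InBranchS-wk Δ U (eG e) brs Z≐

  AltFrom-head : ∀ {G H I X x y} mid → AltFrom G H I X (x ∷ (mid ++ y ∷ [])) → ∃₂ λ u v → StepI G I u v X
  AltFrom-head {x = x} {y} []      (s , _) = x , y , s
  AltFrom-head {x = x}     (m ∷ _) (s , _) = x , m , s

  CompleteAltPath-first-step : ∀ {G H I X x y} → CompleteAltPath G H I X x y →
                               (∃₂ λ u v → StepI G I u v X) ⊎ (∃₂ λ u v → StepI H I u v X)
  CompleteAltPath-first-step (mid , _ , _ , _ , _ , _ , alt) = Sum.map (AltFrom-head mid) (AltFrom-head mid) alt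

  Fits-cut : ∀ A {Γ G H} → Fits G (A ∷ Γ) → Fits H (neg A ∷ Γ) → Fits (comp (names A) G H) Γ
  Fits-cut A {Γ} {G} {H} (fits vG eG) (fits vH eH) = fits vertex label
    where
      vertex : ∀ {z} → V (comp (names A) G H) z → z ∈ namesS Γ
      vertex (inj₁ v , z∉A) = ∈-namesS-∷⁻ A {Γ} (vG v) z∉A
      vertex {z} (inj₂ v , z∉A) =
        ∈-namesS-∷⁻ (neg A) {Γ} (vH v) (λ z∈ → z∉A (subst (z ∈_) (names-neg A) z∈))
      -- A cut edge is labelled by the label of its first step with the cut names removed.
      cut-label : ∀ {C K X} → names C ≡ names A → (∀ {x y Z} → E K x y Z → InBranchS (C ∷ Γ) Z) →
                  (∃₂ λ u v → StepI K (names A) u v X) → InBranchS Γ X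
      cut-label {C} eq eK (_ , _ , _ , e , X≐) = InBranchS-∷⁻ C {Γ} ([ eK , eK ] e) λ {z} z∈ →
        proj₁ (proj₁ (X≐ z) z∈) , λ zC → proj₂ (proj₁ (X≐ z) z∈) (subst (z ∈_) eq zC)
      label : ∀ {x y Z} → E (comp (names A) G H) x y Z → InBranchS Γ Z
      label {x} {y} (_ , _ , _ , _ , path) =
        [ cut-label {A} {G} refl eG , cut-label {neg A} {H} (names-neg A) eH ]
          (CompleteAltPath-first-step {x = x} {y} path)

  Fits-∨∧ : ∀ {A₁ A₂ C₁ C₂ G H} → Distinct (A₁ ∨ A₂ ∷ C₁ ∧ C₂ ∷ []) →
            (Distinct (A₁ ∷ C₁ ∷ []) → Fits G (A₁ ∷ C₁ ∷ [])) →
            (Distinct (A₂ ∷ C₂ ∷ []) → Fits H (A₂ ∷ C₂ ∷ [])) →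
            Fits (wk (A₂ ∷ []) G ⊔ wk (A₁ ∷ []) H) (A₁ ∨ A₂ ∷ C₁ ∧ C₂ ∷ [])
  Fits-∨∧ {A₁} {A₂} {C₁} {C₂} {G} {H} U fitG fitH = Fits-⊔ left right
    where
      U₁ : Distinct (A₁ ∷ C₁ ∷ A₂ ∷ C₂ ∷ [])
      U₁ = Distinct-↭ {A₁ ∷ A₂ ∷ C₁ ∷ C₂ ∷ []} (↭.prep A₁ (↭.swap A₂ C₁ ↭.refl))
             (Distinct-unfold (A₁ ∷ A₂ ∷ []) {C₁ ∧ C₂} {C₁} {C₂} {[]} refl
               (Distinct-unfold [] {A₁ ∨ A₂} {A₁} {A₂} {C₁ ∧ C₂ ∷ []} refl U))
      U₂ : Distinct (A₂ ∷ C₂ ∷ A₁ ∷ C₁ ∷ [])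
      U₂ = Distinct-↭ (++-comm (A₁ ∷ C₁ ∷ []) (A₂ ∷ C₂ ∷ [])) U₁
      U↔ : Distinct (C₁ ∧ C₂ ∷ A₁ ∨ A₂ ∷ [])
      U↔ = Distinct-↭ {A₁ ∨ A₂ ∷ C₁ ∧ C₂ ∷ []} (↭.swap (A₁ ∨ A₂) (C₁ ∧ C₂) ↭.refl) U
      left : Fits (wk (A₂ ∷ []) G) (A₁ ∨ A₂ ∷ C₁ ∧ C₂ ∷ [])
      left = Fits-↭ (↭.swap (C₁ ∧ C₂) (A₁ ∨ A₂) ↭.refl)
           (Fits-∧ˡ C₁ C₂ U↔
           (Fits-↭ (↭.swap (A₁ ∨ A₂) C₁ ↭.refl)
           (Fits-∨ A₁ A₂
           (Fits-↭ (↭.prep A₁ (↭.swap C₁ A₂ ↭.refl))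
           (Fits-wk (A₁ ∷ C₁ ∷ []) (Distinct-++⁻ˡ (A₁ ∷ C₁ ∷ A₂ ∷ []) {C₂ ∷ []} U₁)
             (fitG (Distinct-++⁻ˡ (A₁ ∷ C₁ ∷ []) {A₂ ∷ C₂ ∷ []} U₁)))))))
      right : Fits (wk (A₁ ∷ []) H) (A₁ ∨ A₂ ∷ C₁ ∧ C₂ ∷ [])
      right = Fits-↭ (↭.swap (C₁ ∧ C₂) (A₁ ∨ A₂) ↭.refl)
            (Fits-∧ʳ C₁ C₂ U↔
            (Fits-↭ (↭.swap (A₁ ∨ A₂) C₂ ↭.refl)
            (Fits-∨ A₁ A₂
            (Fits-↭ (↭.trans (↭.prep A₂ (↭.swap C₂ A₁ ↭.refl)) (↭.swap A₂ A₁ ↭.refl))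
            (Fits-wk (A₂ ∷ C₂ ∷ []) (Distinct-++⁻ˡ (A₂ ∷ C₂ ∷ A₁ ∷ []) {C₁ ∷ []} U₂)
              (fitH (Distinct-++⁻ˡ (A₂ ∷ C₂ ∷ []) {A₁ ∷ C₁ ∷ []} U₂)))))))

  Fits-idG : ∀ A C → Distinct (A ∷ C ∷ []) → Fits (idG A C) (A ∷ C ∷ [])
  Fits-idG (atom _ _) (atom _ _) _ = fits id λ (_ , _ , Z≐) → (λ {z} z∈ → proj₁ (Z≐ z) z∈) , tt ∷ tt ∷ []
  Fits-idG (A₁ ∨ A₂) (C₁ ∧ C₂) U = Fits-∨∧ U (Fits-idG A₁ C₁) (Fits-idG A₂ C₂)
  -- idG (C₁ ∧ C₂) (A₁ ∨ A₂) is by definition the same graph as idG (A₁ ∨ A₂) (C₁ ∧ C₂).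
  Fits-idG (C₁ ∧ C₂) (A₁ ∨ A₂) U =
    Fits-↭ (↭.swap (A₁ ∨ A₂) (C₁ ∧ C₂) ↭.refl)
      (Fits-∨∧ (Distinct-↭ {C₁ ∧ C₂ ∷ A₁ ∨ A₂ ∷ []} (↭.swap _ _ ↭.refl) U) (Fits-idG A₁ C₁) (Fits-idG A₂ C₂))
  Fits-idG (atom _ _) (_ ∨ _)    _ = fits (λ ()) (λ ())
  Fits-idG (atom _ _) (_ ∧ _)    _ = fits (λ ()) (λ ())
  Fits-idG (_ ∨ _)    (atom _ _) _ = fits (λ ()) (λ ())
  Fits-idG (_ ∨ _)    (_ ∨ _)    _ = fits (λ ()) (λ ())
  Fits-idG (_ ∧ _)    (atom _ _) _ = fits (λ ()) (λ ())
  Fits-idG (_ ∧ _)    (_ ∧ _)    _ = fits (λ ()) (λ ())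

  Fits-⟦⟧ : ∀ {Δ} (P : Deriv Δ) → Fits ⟦ P ⟧ Δ
  Fits-⟦⟧ (ax Γ A B _ p sf) =
    Fits-↭ (↭-sym p) (Fits-wk (A ∷ neg B ∷ []) U (Fits-idG A (neg B) (Distinct-++⁻ˡ (A ∷ neg B ∷ []) {Γ} U)))
    where U = Distinct-↭ p (SharingFree⇒Distinct sf)
  Fits-⟦⟧ (cut Γ A Q R p _)   = Fits-↭ (↭-sym p) (Fits-cut A (Fits-⟦⟧ Q) (Fits-⟦⟧ R))
  Fits-⟦⟧ (sup Γ Q R p _)     = Fits-↭ (↭-sym p) (Fits-⊔ (Fits-⟦⟧ Q) (Fits-⟦⟧ R))
  Fits-⟦⟧ (or Γ A B Q p _)    = Fits-↭ (↭-sym p) (Fits-∨ A B (Fits-⟦⟧ Q))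
  Fits-⟦⟧ (and Γ A B Q R p sf) =
    Fits-↭ (↭-sym p) (Fits-⊔ (Fits-∧ˡ A B U (Fits-⟦⟧ Q)) (Fits-∧ʳ A B U (Fits-⟦⟧ R)))
    where U = Distinct-↭ p (SharingFree⇒Distinct sf)

  ≅-⊔-↾ : ∀ G X Y → (∀ {z} → V G z → z ∈ X ⊎ z ∈ Y) → (∀ {x y Z} → E G x y Z → Z ⊆ₙ X ⊎ Z ⊆ₙ Y) →
          G ≅ ((G ↾ X) ⊔ (G ↾ Y))
  ≅-⊔-↾ G X Y vsplit esplit =
      (λ z → (λ v → Sum.map (v ,_) (v ,_) (vsplit v)) , [ proj₁ , proj₁ ])
    , (λ x y Z → Product.map₂ (Product.map₂ (Sum.map restrict restrict))
               , Product.map₂ (Product.map₂ (Sum.map [ proj₁ , proj₁ ] [ proj₁ , proj₁ ])))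
    where
      restrict : ∀ {x y Z} → E G x y Z → E ((G ↾ X) ⊔ (G ↾ Y)) x y Z
      restrict e with esplit e
      ... | inj₁ Z⊆X = inj₁ (e , Z⊆X)
      ... | inj₂ Z⊆Y = inj₂ (e , Z⊆Y)

lemma12 : (𝒜 : AtomSet) → let open Named 𝒜 in
    (Γ : Seq) (A B : Formula) (P : Deriv ((A ∧ B) ∷ Γ)) →
    ⟦ P ⟧ ≅ ((⟦ P ⟧ ↾ namesS (A ∷ Γ)) ⊔ (⟦ P ⟧ ↾ namesS (B ∷ Γ)))
lemma12 𝒜 Γ A B P =
  ≅-⊔-↾ ⟦ P ⟧ _ _ (λ v → ∈-namesS-∧⁻ A B {Γ} (vertices v)) (λ e → InBranchS-∧⁻ A B {Γ} (labels e))
  where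
    open BranchLabels 𝒜
    open Fits (Fits-⟦⟧ P)
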